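{- Let $G=(X,Y)$ and $G'=(X',Y')$ be bipartite graphs that both satisfy the double Hall property. Then their bipartite product $G\times G'$ also satisfies the double Hall property.
   Context: All graphs are finite and simple. The bipartite product $G\times G'$ of $G=(X,Y)$ and $G'=(X',Y')$ is the bipartite graph with parts $X\times X'$ and $Y\times Y'$ in which $(x,x')$ is adjacent to $(y,y')$ if and only if $xy\in E(G)$ and $x'y'\in E(G')$. For a vertex set $S$, $\Lambda^2(S)$ denotes the set of vertices adjacent to at least two vertices of $S$. A bipartite graph $G=(X,Y)$ with $|X|\ge 2$ satisfies the double Hall property if $|\Lambda^2(S)|\ge |S|$ for every $S\subseteq X$ with $|S|\ge 2$. -}

module Defs where

open import Data.Nat using (ℕ; _*_; _≤_; _≥_)
open import Data.Bool using (Bool; true; false)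
open import Data.Fin using (Fin; combine; remQuot)
open import Data.Fin.Subset using (Subset; ∣_∣; _∩_)
open import Data.Vec using (tabulate)
open import Data.Product using (_,_; _×_)
open import Relation.Nullary.Decidable using (⌊_⌋)
open import Data.Nat using (_≤?_)

record BipGraph : Set where
  field
    nX  : ℕ
    nY  : ℕ
    adj : Fin nX → Fin nY → Bool
open BipGraph public

-- Bipartite product: parts X × X' and Y × Y' (encoded via Data.Fin.combine,
-- a bijection Fin a × Fin b ≅ Fin (a * b) with inverse remQuot);
-- (x,x') ~ (y,y') iff x ~ y in G and x' ~ y' in G'.
_×ᵇ_ : BipGraph → BipGraph → BipGraph
G ×ᵇ G' = record
  { nX  = nX G * nX G'
  ; nY  = nY G * nY G'
  ; adj = λ u v → go (remQuot (nX G') u) (remQuot (nY G') v)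
  }
  where
  go : _ → _ → Bool
  go (x , x') (y , y') with adj G x y
  ... | true  = adj G' x' y'
  ... | false = false

nbrX : (G : BipGraph) → Fin (nY G) → Subset (nX G)
nbrX G y = tabulate (λ x → adj G x y)

Λ² : (G : BipGraph) → Subset (nX G) → Subset (nY G)
Λ² G S = tabulate (λ y → ⌊ 2 ≤? ∣ S ∩ nbrX G y ∣ ⌋)

DoubleHall : BipGraph → Set
DoubleHall G = (nX G ≥ 2) × ((S : Subset (nX G)) → ∣ S ∣ ≥ 2 → ∣ Λ² G S ∣ ≥ ∣ S ∣)

{-# OPTIONS --safe #-}
module Submission where

-- Split S ⊆ X × X' into its rows S_x ⊆ X' and put w(x,y') = |S_x ∩ N(y')|.  Then
-- (y,y') ∈ Λ²(S) iff Σ_{x ~ y} w(x,y') ≥ 2, so the column of Λ²(S) over y' is the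
-- Λ² in G of the weighting w(·,y') (Λ²ʷ).  Double Hall in G makes that column at
-- least as large as the support of w(·,y') when the support has two or more elements,
-- and otherwise at least as large as {x : w(x,y') ≥ 2}, a set of at most one vertex
-- (which has a neighbour).  Charge y' to each x so counted; every y' ∈ Λ²(S_x) is charged
-- to x.  Double Hall in G' gives row x at least |S_x| charges: via Λ²(S_x) if |S_x| ≥ 2,
-- and if S_x = {c} via a common neighbour y' of c and of an element of another non-empty
-- row, because then the support of w(·,y') has two elements.  Counting the charges both
-- ways gives |S| ≤ |Λ²(S)|.

open import Defs
open import Data.Nat using (ℕ; zero; suc; _+_; _*_; _≤_; _<_; z≤n; s≤s; _≤?_)
open import Data.Nat.Properties
  using (≤-refl; ≤-reflexive; ≤-trans; <-irrefl; >⇒≢; m≤m+n; m≤n+m; +-mono-≤; *-mono-≤;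
         +-assoc; +-identityʳ; +-cancelˡ-<; *-zeroʳ; *-identityˡ; +-*-semiring;
         module ≤-Reasoning)
open import Data.Bool using (Bool; true; false; _∧_)
open import Data.Bool.Properties using (T-≡)
open import Data.Fin using (Fin; zero; suc; combine; remQuot; punchIn; _↑ˡ_; _↑ʳ_)
open import Data.Fin.Properties using (_≟_; suc-injective; punchInᵢ≢i; remQuot-combine)
open import Data.Fin.Subset using (Subset; ∣_∣; _∩_; _∪_; ⁅_⁆; _∈_; _⊆_; Nonempty; Empty)
open import Data.Fin.Subset.Properties
  using (∣⊥∣≡0; Empty-unique; nonempty?; _∈?_; ∣⁅x⁆∣≡1; x∈⁅x⁆; x∈⁅y⁆⇒x≡y; x≢y⇒x∉⁅y⁆;
         p⊆q⇒∣p∣≤∣q∣; p⊂q⇒∣p∣<∣q∣; x∈p∩q⁺; x∈p∩q⁻; x∈p∪q⁺; x∈p∪q⁻; ∪-comm)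
open import Data.Vec using ([]; _∷_; lookup; tabulate)
open import Data.Vec.Properties
  using (lookup∘tabulate; lookup-zipWith; tabulate-cong; []=⇒lookup; lookup⇒[]=)
open import Data.Product using (∃; _×_; _,_; proj₁; proj₂)
open import Data.Sum using (inj₁; inj₂)
open import Function using (_∘_; flip; Equivalence)
open import Relation.Binary.PropositionalEquality
open import Relation.Nullary using (yes; no; contradiction)
open import Relation.Nullary.Decidable using (⌊_⌋; toWitness; fromWitness)
open import Algebra.Properties.Semiring.Sum +-*-semiring

private
  variable
    m n k : ℕ

m<m+n⇒0<n : ∀ m {n} → m < m + n → 0 < n
m<m+n⇒0<n m {n} m<m+n = +-cancelˡ-< m 0 n (subst (_< m + n) (sym (+-identityʳ m)) m<m+n)

another : 2 ≤ n → (i : Fin n) → ∃ λ j → j ≢ i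
another (s≤s (s≤s _)) i = punchIn i zero , punchInᵢ≢i i zero

∑-mono-≤ : {f g : Fin n → ℕ} → (∀ i → f i ≤ g i) → ∑[ i < n ] f i ≤ ∑[ i < n ] g i
∑-mono-≤ {zero}  f≤g = z≤n
∑-mono-≤ {suc n} f≤g = +-mono-≤ (f≤g zero) (∑-mono-≤ (λ i → f≤g (suc i)))

term≤∑ : (f : Fin n → ℕ) (i : Fin n) → f i ≤ ∑[ j < n ] f j
term≤∑ f zero    = m≤m+n (f zero) _
term≤∑ f (suc i) = ≤-trans (term≤∑ (λ j → f (suc j)) i) (m≤n+m _ (f zero))

∑-pos⇒∃-pos : (f : Fin n → ℕ) → 0 < ∑[ i < n ] f i → ∃ λ i → 0 < f i
∑-pos⇒∃-pos {suc n} f 0<∑ with f zero in eq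
... | suc _ = zero , subst (0 <_) (sym eq) (s≤s z≤n)
... | zero  with ∑-pos⇒∃-pos (λ i → f (suc i)) 0<∑
...   | i , 0<fi = suc i , 0<fi

∑-pos-elsewhere : (f : Fin n → ℕ) (i : Fin n) → f i < ∑[ j < n ] f j →
                  ∃ λ j → j ≢ i × 0 < f j
∑-pos-elsewhere {suc n} f zero    fi<∑ with ∑-pos⇒∃-pos (f ∘ suc) (m<m+n⇒0<n (f zero) fi<∑)
... | j , 0<fj = suc j , (λ ()) , 0<fj
∑-pos-elsewhere {suc n} f (suc i) fi<∑ with f zero in eq
... | suc _ = zero , (λ ()) , subst (0 <_) (sym eq) (s≤s z≤n)
... | zero  with ∑-pos-elsewhere {n} (f ∘ suc) i fi<∑
...   | j , j≢i , 0<fj = suc j , j≢i ∘ suc-injective , 0<fj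

∑-splitAt : (f : Fin (m + n) → ℕ) →
            ∑[ k < m + n ] f k ≡ ∑[ i < m ] f (i ↑ˡ n) + ∑[ j < n ] f (m ↑ʳ j)
∑-splitAt {zero}      f = refl
∑-splitAt {suc m} {n} f =
  trans (cong (f zero +_) (∑-splitAt {m} {n} (f ∘ suc))) (sym (+-assoc (f zero) _ _))

∑-combine : (f : Fin (m * n) → ℕ) →
            ∑[ k < m * n ] f k ≡ ∑[ i < m ] ∑[ j < n ] f (combine i j)
∑-combine {zero}      f = refl
∑-combine {suc m} {n} f =
  trans (∑-splitAt {n} f) (cong (∑[ j < n ] f (j ↑ˡ m * n) +_) (∑-combine {m} {n} (f ∘ (n ↑ʳ_))))

𝟙 : Bool → ℕ
𝟙 true  = 1
𝟙 false = 0

𝟙[s∧a∧b]≡𝟙a*𝟙[s∧b] : ∀ s a b → 𝟙 (s ∧ (a ∧ b)) ≡ 𝟙 a * 𝟙 (s ∧ b)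
𝟙[s∧a∧b]≡𝟙a*𝟙[s∧b] false a     b = sym (*-zeroʳ (𝟙 a))
𝟙[s∧a∧b]≡𝟙a*𝟙[s∧b] true  true  b = sym (+-identityʳ (𝟙 b))
𝟙[s∧a∧b]≡𝟙a*𝟙[s∧b] true  false b = refl

⌊k≤?n⌋≡true : ∀ {k n} → k ≤ n → ⌊ k ≤? n ⌋ ≡ true
⌊k≤?n⌋≡true {k} {n} k≤n = Equivalence.to T-≡ (fromWitness {a? = k ≤? n} k≤n)

𝟙⌊k≤?n⌋-antitone : ∀ {j k n} → j ≤ k → 𝟙 ⌊ k ≤? n ⌋ ≤ 𝟙 ⌊ j ≤? n ⌋
𝟙⌊k≤?n⌋-antitone {j} {k} {n} j≤k with k ≤? n
... | no  _   = z≤n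
... | yes k≤n = ≤-reflexive (cong 𝟙 (sym (⌊k≤?n⌋≡true (≤-trans j≤k k≤n))))

∣p∣≡∑𝟙 : (p : Subset n) → ∣ p ∣ ≡ ∑[ i < n ] 𝟙 (lookup p i)
∣p∣≡∑𝟙 []          = refl
∣p∣≡∑𝟙 (true  ∷ p) = cong suc (∣p∣≡∑𝟙 p)
∣p∣≡∑𝟙 (false ∷ p) = ∣p∣≡∑𝟙 p

∣tabulate∣≡∑𝟙 : (f : Fin n → Bool) → ∣ tabulate f ∣ ≡ ∑[ i < n ] 𝟙 (f i)
∣tabulate∣≡∑𝟙 f = trans (∣p∣≡∑𝟙 (tabulate f)) (sum-cong-≗ (cong 𝟙 ∘ lookup∘tabulate f))

∈-tabulate⁺ : {f : Fin n → Bool} {i : Fin n} → f i ≡ true → i ∈ tabulate f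
∈-tabulate⁺ {f = f} {i} fi≡true =
  lookup⇒[]= i (tabulate f) (trans (lookup∘tabulate f i) fi≡true)

∈-tabulate⁻ : {f : Fin n → Bool} {i : Fin n} → i ∈ tabulate f → f i ≡ true
∈-tabulate⁻ {f = f} {i} i∈ = trans (sym (lookup∘tabulate f i)) ([]=⇒lookup i∈)

Empty⇒∣p∣≡0 : {p : Subset n} → Empty p → ∣ p ∣ ≡ 0
Empty⇒∣p∣≡0 {n} empty = trans (cong ∣_∣ (Empty-unique empty)) (∣⊥∣≡0 n)

0<∣p∣⇒Nonempty : {p : Subset n} → 0 < ∣ p ∣ → Nonempty p
0<∣p∣⇒Nonempty {p = p} 0<∣p∣ with nonempty? p
... | yes ne    = ne
... | no  empty = contradiction (Empty⇒∣p∣≡0 empty) (>⇒≢ 0<∣p∣)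

x∈p⇒⁅x⁆⊆p : {p : Subset n} {x : Fin n} → x ∈ p → ⁅ x ⁆ ⊆ p
x∈p⇒⁅x⁆⊆p {x = x} x∈p y∈⁅x⁆ rewrite x∈⁅y⁆⇒x≡y x y∈⁅x⁆ = x∈p

x∈p⇒0<∣p∣ : {p : Subset n} {x : Fin n} → x ∈ p → 0 < ∣ p ∣
x∈p⇒0<∣p∣ {x = x} x∈p = subst (_≤ _) (∣⁅x⁆∣≡1 x) (p⊆q⇒∣p∣≤∣q∣ (x∈p⇒⁅x⁆⊆p x∈p))

x≢y⇒2≤∣p∣ : {p : Subset n} {x y : Fin n} → x ≢ y → x ∈ p → y ∈ p → 2 ≤ ∣ p ∣
x≢y⇒2≤∣p∣ {x = x} x≢y x∈p y∈p = subst (_< _) (∣⁅x⁆∣≡1 x)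
  (p⊂q⇒∣p∣<∣q∣ (x∈p⇒⁅x⁆⊆p x∈p , _ , y∈p , x≢y⇒x∉⁅y⁆ (x≢y ∘ sym)))

2≤∣⁅x⁆∪⁅y⁆∩p∣⇒x,y∈p : {p : Subset n} (x y : Fin n) →
                       2 ≤ ∣ (⁅ x ⁆ ∪ ⁅ y ⁆) ∩ p ∣ → x ∈ p × y ∈ p
2≤∣⁅x⁆∪⁅y⁆∩p∣⇒x,y∈p {p = p} x y 2≤∣pair∩p∣ =
  member x y 2≤∣pair∩p∣ , member y x (subst (λ r → 2 ≤ ∣ r ∩ p ∣) (∪-comm ⁅ x ⁆ ⁅ y ⁆) 2≤∣pair∩p∣)
  where
  member : ∀ a b → 2 ≤ ∣ (⁅ a ⁆ ∪ ⁅ b ⁆) ∩ p ∣ → a ∈ p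
  member a b 2≤∣pair∩p∣ with a ∈? p
  ... | yes a∈p = a∈p
  ... | no  a∉p = contradiction (≤-trans 2≤∣pair∩p∣ ∣pair∩p∣≤1) (<-irrefl refl)
    where
    pair∩p⊆⁅b⁆ : (⁅ a ⁆ ∪ ⁅ b ⁆) ∩ p ⊆ ⁅ b ⁆
    pair∩p⊆⁅b⁆ c∈ with x∈p∩q⁻ (⁅ a ⁆ ∪ ⁅ b ⁆) p c∈
    ... | c∈pair , c∈p with x∈p∪q⁻ ⁅ a ⁆ ⁅ b ⁆ c∈pair
    ...   | inj₁ c∈⁅a⁆ = contradiction (subst (_∈ p) (x∈⁅y⁆⇒x≡y a c∈⁅a⁆) c∈p) a∉p
    ...   | inj₂ c∈⁅b⁆ = c∈⁅b⁆
    ∣pair∩p∣≤1 : ∣ (⁅ a ⁆ ∪ ⁅ b ⁆) ∩ p ∣ ≤ 1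
    ∣pair∩p∣≤1 = subst (∣ (⁅ a ⁆ ∪ ⁅ b ⁆) ∩ p ∣ ≤_) (∣⁅x⁆∣≡1 b) (p⊆q⇒∣p∣≤∣q∣ pair∩p⊆⁅b⁆)

row : Subset (m * n) → Fin m → Subset n
row p i = tabulate (λ j → lookup p (combine i j))

∣p∣≡∑∣row∣ : (p : Subset (m * n)) → ∣ p ∣ ≡ ∑[ i < m ] ∣ row p i ∣
∣p∣≡∑∣row∣ {m} {n} p = begin
  ∣ p ∣                                             ≡⟨ ∣p∣≡∑𝟙 p ⟩
  ∑[ k < m * n ] 𝟙 (lookup p k)                     ≡⟨ ∑-combine {m} {n} _ ⟩
  ∑[ i < m ] ∑[ j < n ] 𝟙 (lookup p (combine i j))  ≡⟨ sum-cong-≗ {m} ∑𝟙≡∣row∣ ⟨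
  ∑[ i < m ] ∣ row {m} {n} p i ∣                    ∎
  where
  open ≡-Reasoning
  ∑𝟙≡∣row∣ : ∀ i → ∣ row p i ∣ ≡ ∑[ j < n ] 𝟙 (lookup p (combine i j))
  ∑𝟙≡∣row∣ i = ∣tabulate∣≡∑𝟙 {n} (λ j → lookup p (combine i j))

-- Λ² G S is by definition atLeast 2 (λ y → ∣ S ∩ nbrX G y ∣).
atLeast : ℕ → (Fin n → ℕ) → Subset n
atLeast k f = tabulate (λ i → ⌊ k ≤? f i ⌋)

∈-atLeast⁺ : {f : Fin n → ℕ} {i : Fin n} → k ≤ f i → i ∈ atLeast k f
∈-atLeast⁺ k≤fi = ∈-tabulate⁺ (⌊k≤?n⌋≡true k≤fi)

∈-atLeast⁻ : {f : Fin n → ℕ} {i : Fin n} → i ∈ atLeast k f → k ≤ f i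
∈-atLeast⁻ i∈ = toWitness (Equivalence.from T-≡ (∈-tabulate⁻ i∈))

atLeast-⊆ : ∀ {j} {f g : Fin n → ℕ} → j ≤ k → (∀ i → f i ≤ g i) → atLeast k f ⊆ atLeast j g
atLeast-⊆ {f = f} j≤k f≤g {i} i∈ =
  ∈-atLeast⁺ (≤-trans j≤k (≤-trans (∈-atLeast⁻ {f = f} i∈) (f≤g i)))

∣atLeast∣≡∑-columns : (f : Fin (m * n) → ℕ) →
                      ∣ atLeast k f ∣ ≡ ∑[ j < n ] ∣ atLeast k (λ (i : Fin m) → f (combine i j)) ∣
∣atLeast∣≡∑-columns {m} {n} {k} f = begin
  ∣ atLeast k f ∣                                    ≡⟨ ∣tabulate∣≡∑𝟙 (λ l → ⌊ k ≤? f l ⌋) ⟩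
  ∑[ l < m * n ] 𝟙 ⌊ k ≤? f l ⌋                      ≡⟨ ∑-combine {m} {n} (λ l → 𝟙 ⌊ k ≤? f l ⌋) ⟩
  ∑[ i < m ] ∑[ j < n ] 𝟙 ⌊ k ≤? f (combine i j) ⌋   ≡⟨ ∑-comm {m} {n} indicator ⟩
  ∑[ j < n ] ∑[ i < m ] 𝟙 ⌊ k ≤? f (combine i j) ⌋   ≡⟨ sum-cong-≗ {n} ∑𝟙≡∣column∣ ⟨
  ∑[ j < n ] ∣ atLeast k (λ (i : Fin m) → f (combine i j)) ∣ ∎
  where
  open ≡-Reasoning
  indicator : Fin m → Fin n → ℕ
  indicator i j = 𝟙 ⌊ k ≤? f (combine i j) ⌋
  ∑𝟙≡∣column∣ : ∀ j → ∣ atLeast k (λ (i : Fin m) → f (combine i j)) ∣ ≡ ∑[ i < m ] indicator i j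
  ∑𝟙≡∣column∣ j = ∣tabulate∣≡∑𝟙 {m} (λ i → ⌊ k ≤? f (combine i j) ⌋)

threshold : ℕ → ℕ
threshold (suc (suc _)) = 1
threshold _             = 2

threshold-≥2 : 2 ≤ n → threshold n ≡ 1
threshold-≥2 (s≤s (s≤s _)) = refl

threshold≤2 : ∀ n → threshold n ≤ 2
threshold≤2 (suc (suc _)) = s≤s z≤n
threshold≤2 0             = ≤-refl
threshold≤2 1             = ≤-refl

module _ (G : BipGraph) where

  ∣p∩nbrX∣≡∑ : (p : Subset (nX G)) (y : Fin (nY G)) →
               ∣ p ∩ nbrX G y ∣ ≡ ∑[ x < nX G ] 𝟙 (lookup p x ∧ adj G x y)
  ∣p∩nbrX∣≡∑ p y = trans (∣p∣≡∑𝟙 (p ∩ nbrX G y)) (sum-cong-≗ {nX G} λ x → cong 𝟙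
    (trans (lookup-zipWith _∧_ x p (nbrX G y)) (cong (lookup p x ∧_) (lookup∘tabulate _ x))))

  ∈-Λ²⁻ : (S : Subset (nX G)) {y : Fin (nY G)} → y ∈ Λ² G S → 2 ≤ ∣ S ∩ nbrX G y ∣
  ∈-Λ²⁻ S = ∈-atLeast⁻ {f = λ y → ∣ S ∩ nbrX G y ∣}

  commonNeighbour-≢ : DoubleHall G → ∀ {x₁ x₂} → x₁ ≢ x₂ →
                      ∃ λ y → x₁ ∈ nbrX G y × x₂ ∈ nbrX G y
  commonNeighbour-≢ (_ , hall) {x₁} {x₂} x₁≢x₂
    with 0<∣p∣⇒Nonempty {p = Λ² G pair} 0<∣Λ²pair∣
    where
    pair : Subset (nX G)
    pair = ⁅ x₁ ⁆ ∪ ⁅ x₂ ⁆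
    2≤∣pair∣ : 2 ≤ ∣ pair ∣
    2≤∣pair∣ = x≢y⇒2≤∣p∣ x₁≢x₂ (x∈p∪q⁺ (inj₁ (x∈⁅x⁆ x₁))) (x∈p∪q⁺ (inj₂ (x∈⁅x⁆ x₂)))
    0<∣Λ²pair∣ : 0 < ∣ Λ² G pair ∣
    0<∣Λ²pair∣ = ≤-trans (s≤s z≤n) (≤-trans 2≤∣pair∣ (hall pair 2≤∣pair∣))
  ... | y , y∈Λ² = y , 2≤∣⁅x⁆∪⁅y⁆∩p∣⇒x,y∈p x₁ x₂ (∈-Λ²⁻ (⁅ x₁ ⁆ ∪ ⁅ x₂ ⁆) y∈Λ²)

  commonNeighbour : DoubleHall G → ∀ x₁ x₂ → ∃ λ y → x₁ ∈ nbrX G y × x₂ ∈ nbrX G y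
  commonNeighbour dh x₁ x₂ with x₁ ≟ x₂
  ... | no  x₁≢x₂ = commonNeighbour-≢ dh x₁≢x₂
  ... | yes refl  with another (proj₁ dh) x₁
  ...   | x₃ , x₃≢x₁ with commonNeighbour-≢ dh (x₃≢x₁ ∘ sym)
  ...     | y , x₁~y , _ = y , x₁~y , x₁~y

  Λ²ʷ : (Fin (nX G) → ℕ) → Subset (nY G)
  Λ²ʷ v = atLeast 2 (λ y → ∑[ x < nX G ] (𝟙 (adj G x y) * v x))

  Λ²-support⊆Λ²ʷ : (v : Fin (nX G) → ℕ) → Λ² G (atLeast 1 v) ⊆ Λ²ʷ v
  Λ²-support⊆Λ²ʷ v = atLeast-⊆ ≤-refl λ y → begin
    ∣ atLeast 1 v ∩ nbrX G y ∣                            ≡⟨ ∣p∩nbrX∣≡∑ (atLeast 1 v) y ⟩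
    ∑[ x < nX G ] 𝟙 (lookup (atLeast 1 v) x ∧ adj G x y)  ≡⟨ sum-cong-≗ {nX G} (lookup-support y) ⟩
    ∑[ x < nX G ] 𝟙 (⌊ 1 ≤? v x ⌋ ∧ adj G x y)            ≤⟨ ∑-mono-≤ {nX G} (≤-weight y) ⟩
    ∑[ x < nX G ] (𝟙 (adj G x y) * v x)                   ∎
    where
    open ≤-Reasoning
    lookup-support : ∀ y x → 𝟙 (lookup (atLeast 1 v) x ∧ adj G x y) ≡ 𝟙 (⌊ 1 ≤? v x ⌋ ∧ adj G x y)
    lookup-support y x = cong (λ b → 𝟙 (b ∧ adj G x y)) (lookup∘tabulate _ x)
    𝟙[0<n∧b]≤𝟙b*n : ∀ n b → 𝟙 (⌊ 1 ≤? n ⌋ ∧ b) ≤ 𝟙 b * n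
    𝟙[0<n∧b]≤𝟙b*n zero    b     = z≤n
    𝟙[0<n∧b]≤𝟙b*n (suc n) true  = s≤s z≤n
    𝟙[0<n∧b]≤𝟙b*n (suc n) false = z≤n
    ≤-weight : ∀ y x → 𝟙 (⌊ 1 ≤? v x ⌋ ∧ adj G x y) ≤ 𝟙 (adj G x y) * v x
    ≤-weight y x = 𝟙[0<n∧b]≤𝟙b*n (v x) (adj G x y)

  doubleHallʷ-dense : DoubleHall G → (v : Fin (nX G) → ℕ) →
                      2 ≤ ∣ atLeast 1 v ∣ → ∣ atLeast 1 v ∣ ≤ ∣ Λ²ʷ v ∣
  doubleHallʷ-dense (_ , hall) v 2≤∣supp∣ =
    ≤-trans (hall (atLeast 1 v) 2≤∣supp∣) (p⊆q⇒∣p∣≤∣q∣ (Λ²-support⊆Λ²ʷ v))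

  doubleHallʷ-sparse : DoubleHall G → (v : Fin (nX G) → ℕ) →
                       ∣ atLeast 1 v ∣ ≤ 1 → ∣ atLeast 2 v ∣ ≤ ∣ Λ²ʷ v ∣
  doubleHallʷ-sparse dh v ∣supp∣≤1 with nonempty? (atLeast 2 v)
  ... | no  empty    = subst (_≤ ∣ Λ²ʷ v ∣) (sym (Empty⇒∣p∣≡0 empty)) z≤n
  ... | yes (x , x∈) with commonNeighbour dh x x
  ...   | y , x~y , _ = ≤-trans ∣atLeast2∣≤1 (x∈p⇒0<∣p∣ {p = Λ²ʷ v} (∈-atLeast⁺ 2≤∑))
    where
    ∣atLeast2∣≤1 : ∣ atLeast 2 v ∣ ≤ 1
    ∣atLeast2∣≤1 = ≤-trans (p⊆q⇒∣p∣≤∣q∣ (atLeast-⊆ {f = v} (s≤s z≤n) (λ _ → ≤-refl))) ∣supp∣≤1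
    vx≡ : v x ≡ 𝟙 (adj G x y) * v x
    vx≡ = sym (trans (cong (λ b → 𝟙 b * v x) (∈-tabulate⁻ x~y)) (*-identityˡ (v x)))
    2≤∑ : 2 ≤ ∑[ x′ < nX G ] (𝟙 (adj G x′ y) * v x′)
    2≤∑ = ≤-trans (∈-atLeast⁻ {f = v} x∈)
            (≤-trans (≤-reflexive vx≡) (term≤∑ (λ x′ → 𝟙 (adj G x′ y) * v x′) x))

  doubleHallʷ : DoubleHall G → (v : Fin (nX G) → ℕ) →
                ∣ atLeast (threshold ∣ atLeast 1 v ∣) v ∣ ≤ ∣ Λ²ʷ v ∣
  doubleHallʷ dh v with ∣ atLeast 1 v ∣ in eq
  ... | 0           = doubleHallʷ-sparse dh v (subst (_≤ 1) (sym eq) z≤n)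
  ... | 1           = doubleHallʷ-sparse dh v (≤-reflexive eq)
  ... | suc (suc _) = doubleHallʷ-dense dh v (subst (2 ≤_) (sym eq) (s≤s (s≤s z≤n)))

module _ (G G' : BipGraph) where

  adj-×ᵇ : ∀ x x' y y' → adj (G ×ᵇ G') (combine x x') (combine y y') ≡ adj G x y ∧ adj G' x' y'
  adj-×ᵇ x x' y y' = trans (adj-×ᵇ-remQuot (combine x x') (combine y y'))
    (cong₂ (λ (p : Fin (nX G) × Fin (nX G')) (q : Fin (nY G) × Fin (nY G')) →
             adj G (proj₁ p) (proj₁ q) ∧ adj G' (proj₂ p) (proj₂ q))
           (remQuot-combine x x') (remQuot-combine y y'))
    where
    adj-×ᵇ-remQuot : ∀ u v → adj (G ×ᵇ G') u v ≡
                     adj G (proj₁ (remQuot {nX G} (nX G') u)) (proj₁ (remQuot {nY G} (nY G') v)) ∧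
                     adj G' (proj₂ (remQuot {nX G} (nX G') u)) (proj₂ (remQuot {nY G} (nY G') v))
    -- _×ᵇ_ computes adjacency by a with on adj G, so the proof splits on the same term.
    adj-×ᵇ-remQuot u v
      with adj G (proj₁ (remQuot {nX G} (nX G') u)) (proj₁ (remQuot {nY G} (nY G') v))
    ... | true  = refl
    ... | false = refl

  ∣S∩nbrX-×ᵇ∣ : (S : Subset (nX G * nX G')) (y : Fin (nY G)) (y' : Fin (nY G')) →
                ∣ S ∩ nbrX (G ×ᵇ G') (combine y y') ∣ ≡
                ∑[ x < nX G ] (𝟙 (adj G x y) * ∣ row S x ∩ nbrX G' y' ∣)
  ∣S∩nbrX-×ᵇ∣ S y y' = begin
    ∣ S ∩ nbrX P (combine y y') ∣
      ≡⟨ ∣p∩nbrX∣≡∑ P S (combine y y') ⟩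
    ∑[ u < a * a' ] 𝟙 (lookup S u ∧ adj P u (combine y y'))
      ≡⟨ ∑-combine {a} {a'} (λ u → 𝟙 (lookup S u ∧ adj P u (combine y y'))) ⟩
    ∑[ x < a ] ∑[ x' < a' ] 𝟙 (lookup S (combine x x') ∧ adj P (combine x x') (combine y y'))
      ≡⟨ sum-cong-≗ {a} (λ x → sum-cong-≗ {a'} (factor x)) ⟩
    ∑[ x < a ] ∑[ x' < a' ] (𝟙 (adj G x y) * 𝟙 (lookup (row S x) x' ∧ adj G' x' y'))
      ≡⟨ sum-cong-≗ {a} (λ x → *-distribˡ-sum (𝟙 (adj G x y)) (rowTerm x)) ⟨
    ∑[ x < a ] (𝟙 (adj G x y) * ∑[ x' < a' ] rowTerm x x')
      ≡⟨ sum-cong-≗ {a} (λ x → cong (𝟙 (adj G x y) *_) (∣p∩nbrX∣≡∑ G' (row S x) y')) ⟨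
    ∑[ x < a ] (𝟙 (adj G x y) * ∣ row S x ∩ nbrX G' y' ∣)
      ∎
    where
    open ≡-Reasoning
    P = G ×ᵇ G'
    a = nX G
    a' = nX G'
    rowTerm : Fin a → Fin a' → ℕ
    rowTerm x x' = 𝟙 (lookup (row S x) x' ∧ adj G' x' y')
    factor : ∀ x x' → 𝟙 (lookup S (combine x x') ∧ adj P (combine x x') (combine y y')) ≡
                      𝟙 (adj G x y) * rowTerm x x'
    factor x x' rewrite adj-×ᵇ x x' y y' | lookup∘tabulate (λ j → lookup S (combine x j)) x' =
      𝟙[s∧a∧b]≡𝟙a*𝟙[s∧b] (lookup S (combine x x')) (adj G x y) (adj G' x' y')

  ∣Λ²-×ᵇ∣ : (S : Subset (nX G * nX G')) →
            ∣ Λ² (G ×ᵇ G') S ∣ ≡ ∑[ y' < nY G' ] ∣ Λ²ʷ G (λ x → ∣ row S x ∩ nbrX G' y' ∣) ∣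
  ∣Λ²-×ᵇ∣ S = trans (∣atLeast∣≡∑-columns {nY G} {nY G'} (λ u → ∣ S ∩ nbrX (G ×ᵇ G') u ∣))
    (sum-cong-≗ {nY G'} λ y' → cong ∣_∣ (tabulate-cong λ y →
      cong (λ n → ⌊ 2 ≤? n ⌋) (∣S∩nbrX-×ᵇ∣ S y y')))

module _ {G G' : BipGraph} (dh : DoubleHall G) (dh' : DoubleHall G')
         (S : Subset (nX G * nX G')) (2≤∣S∣ : 2 ≤ ∣ S ∣) where

  w : Fin (nX G) → Fin (nY G') → ℕ
  w x y' = ∣ row S x ∩ nbrX G' y' ∣

  θ : Fin (nY G') → ℕ
  θ y' = threshold ∣ atLeast 1 (λ x → w x y') ∣

  charge : Fin (nX G) → Fin (nY G') → ℕ
  charge x y' = 𝟙 ⌊ θ y' ≤? w x y' ⌋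

  ∣row∣≡1⇒charged : ∀ x → ∣ row S x ∣ ≡ 1 → ∃ λ y' → charge x y' ≡ 1
  ∣row∣≡1⇒charged x ∣Sₓ∣≡1 with 0<∣p∣⇒Nonempty (subst (0 <_) (sym ∣Sₓ∣≡1) (s≤s z≤n))
                              | ∑-pos-elsewhere {nX G} (λ x → ∣ row S x ∣) x ∣Sₓ∣<∑
    where
    ∣Sₓ∣<∑ : ∣ row S x ∣ < ∑[ x < nX G ] ∣ row S x ∣
    ∣Sₓ∣<∑ = subst₂ _<_ (sym ∣Sₓ∣≡1) (∣p∣≡∑∣row∣ {nX G} {nX G'} S) 2≤∣S∣
  ... | c₁ , c₁∈Sₓ | x₂ , x₂≢x , 0<∣Sₓ₂∣ with 0<∣p∣⇒Nonempty 0<∣Sₓ₂∣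
  ... | c₂ , c₂∈Sₓ₂ with commonNeighbour G' dh' c₁ c₂
  ... | y' , c₁~y' , c₂~y' =
    y' , cong 𝟙 (⌊k≤?n⌋≡true (subst (_≤ w x y') (sym θ≡1) (∈-atLeast⁻ x∈supp)))
    where
    x∈supp : x ∈ atLeast 1 (λ x → w x y')
    x∈supp = ∈-atLeast⁺ (x∈p⇒0<∣p∣ {p = row S x ∩ nbrX G' y'} (x∈p∩q⁺ (c₁∈Sₓ , c₁~y')))
    x₂∈supp : x₂ ∈ atLeast 1 (λ x → w x y')
    x₂∈supp = ∈-atLeast⁺ (x∈p⇒0<∣p∣ {p = row S x₂ ∩ nbrX G' y'} (x∈p∩q⁺ (c₂∈Sₓ₂ , c₂~y')))
    θ≡1 : θ y' ≡ 1
    θ≡1 = threshold-≥2 (x≢y⇒2≤∣p∣ (x₂≢x ∘ sym) x∈supp x₂∈supp)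

  ∣row∣≤∑charge : ∀ x → ∣ row S x ∣ ≤ ∑[ y' < nY G' ] charge x y'
  ∣row∣≤∑charge x with ∣ row S x ∣ in ∣Sₓ∣≡
  ... | 0 = z≤n
  ... | 1 with ∣row∣≡1⇒charged x ∣Sₓ∣≡
  ...   | y' , charged = subst (_≤ _) charged (term≤∑ (charge x) y')
  ∣row∣≤∑charge x | suc (suc k) = begin
    suc (suc k)                        ≡⟨ ∣Sₓ∣≡ ⟨
    ∣ row S x ∣                        ≤⟨ proj₂ dh' (row S x) 2≤∣Sₓ∣ ⟩
    ∣ Λ² G' (row S x) ∣                ≡⟨ ∣tabulate∣≡∑𝟙 (λ y' → ⌊ 2 ≤? w x y' ⌋) ⟩
    ∑[ y' < nY G' ] 𝟙 ⌊ 2 ≤? w x y' ⌋  ≤⟨ ∑-mono-≤ {nY G'} (λ _ → 𝟙⌊k≤?n⌋-antitone (threshold≤2 _)) ⟩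
    ∑[ y' < nY G' ] charge x y'        ∎
    where
    open ≤-Reasoning
    2≤∣Sₓ∣ : 2 ≤ ∣ row S x ∣
    2≤∣Sₓ∣ = subst (2 ≤_) (sym ∣Sₓ∣≡) (s≤s (s≤s z≤n))

  ∣S∣≤∣Λ²S∣ : ∣ S ∣ ≤ ∣ Λ² (G ×ᵇ G') S ∣
  ∣S∣≤∣Λ²S∣ = begin
    ∣ S ∣                                            ≡⟨ ∣p∣≡∑∣row∣ {nX G} {nX G'} S ⟩
    ∑[ x < nX G ] ∣ row S x ∣                         ≤⟨ ∑-mono-≤ {nX G} ∣row∣≤∑charge ⟩
    ∑[ x < nX G ] ∑[ y' < nY G' ] charge x y'         ≡⟨ ∑-comm {nX G} {nY G'} charge ⟩
    ∑[ y' < nY G' ] ∑[ x < nX G ] charge x y'         ≡⟨ sum-cong-≗ {nY G'} ∑charge≡∣atLeast∣ ⟨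
    ∑[ y' < nY G' ] ∣ atLeast (θ y') (λ x → w x y') ∣ ≤⟨ ∑-mono-≤ {nY G'} (doubleHallʷ G dh ∘ flip w) ⟩
    ∑[ y' < nY G' ] ∣ Λ²ʷ G (λ x → w x y') ∣          ≡⟨ ∣Λ²-×ᵇ∣ G G' S ⟨
    ∣ Λ² (G ×ᵇ G') S ∣                                ∎
    where
    open ≤-Reasoning
    ∑charge≡∣atLeast∣ : ∀ y' → ∣ atLeast (θ y') (λ x → w x y') ∣ ≡ ∑[ x < nX G ] charge x y'
    ∑charge≡∣atLeast∣ y' = ∣tabulate∣≡∑𝟙 (λ x → ⌊ θ y' ≤? w x y' ⌋)

lemma5p3 : (G G' : BipGraph) → DoubleHall G → DoubleHall G' → DoubleHall (G ×ᵇ G')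
lemma5p3 G G' dh dh' = ≤-trans (s≤s (s≤s z≤n)) (*-mono-≤ (proj₁ dh) (proj₁ dh'))
                     , ∣S∣≤∣Λ²S∣ {G} {G'} dh dh'
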